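{- For every nonnegative integer $s$, $d_4(21s+11,3)=16s+7$, $d_4(21s+16,3)=16s+11$, and $d_4(21s+20,3)=16s+14$.
   Context: $\mathbb{F}_4=\{0,1,\omega,\omega^2\}$ with $\omega^2=\omega+1$, $\overline{x}=x^2$. A quaternary $[n,k]$ code is a $k$-dimensional subspace of $\mathbb{F}_4^n$; its minimum weight is its minimum nonzero Hamming weight. The Hermitian dual is $C^{\perp_H}=\{x : \sum_i x_i\overline{y_i}=0\ \forall y\in C\}$, and $C$ is Hermitian LCD if $C\cap C^{\perp_H}=\{0\}$. $d_4(n,k)$ is the largest minimum weight among all quaternary Hermitian LCD $[n,k]$ codes. -}

module Defs where

open import Data.Nat using (ℕ; zero; suc; _+_; _≤_)
open import Data.Vec using (Vec; []; _∷_; replicate; zipWith; foldr; lookup)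
open import Data.Product using (Σ; _×_; _,_; ∃)
open import Relation.Binary.PropositionalEquality using (_≡_; _≢_)

data F4 : Set where
  𝟎 𝟏 ω ω² : F4

infixl 6 _⊕_
infixl 7 _⊗_

_⊕_ : F4 → F4 → F4
𝟎  ⊕ y  = y
x  ⊕ 𝟎  = x
𝟏  ⊕ 𝟏  = 𝟎
𝟏  ⊕ ω  = ω²
𝟏  ⊕ ω² = ω
ω  ⊕ 𝟏  = ω²
ω  ⊕ ω  = 𝟎
ω  ⊕ ω² = 𝟏
ω² ⊕ 𝟏  = ω
ω² ⊕ ω  = 𝟏
ω² ⊕ ω² = 𝟎

_⊗_ : F4 → F4 → F4
𝟎  ⊗ y  = 𝟎
x  ⊗ 𝟎  = 𝟎
𝟏  ⊗ y  = y
x  ⊗ 𝟏  = x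
ω  ⊗ ω  = ω²
ω  ⊗ ω² = 𝟏
ω² ⊗ ω  = 𝟏
ω² ⊗ ω² = ω

conj : F4 → F4
conj x = x ⊗ x

Word : ℕ → Set
Word n = Vec F4 n

zeroW : ∀ {n} → Word n
zeroW = replicate _ 𝟎

_+W_ : ∀ {n} → Word n → Word n → Word n
_+W_ = zipWith _⊕_

scale : ∀ {n} → F4 → Word n → Word n
scale a = Data.Vec.map (a ⊗_)

wt : ∀ {n} → Word n → ℕ
wt [] = 0
wt (𝟎 ∷ v) = wt v
wt (𝟏 ∷ v) = suc (wt v)
wt (ω ∷ v) = suc (wt v)
wt (ω² ∷ v) = suc (wt v)

herm : ∀ {n} → Word n → Word n → F4
herm x y = foldr _ _⊕_ 𝟎 (zipWith (λ a b → a ⊗ conj b) x y)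

GenMat : ℕ → ℕ → Set
GenMat k n = Vec (Word n) k

encode : ∀ {k n} → GenMat k n → Vec F4 k → Word n
encode [] [] = zeroW
encode (g ∷ G) (a ∷ u) = scale a g +W encode G u

_∈C_ : ∀ {k n} → Word n → GenMat k n → Set
x ∈C G = ∃ λ u → encode G u ≡ x

Independent : ∀ {k n} → GenMat k n → Set
Independent {k} G = ∀ (u : Vec F4 k) → encode G u ≡ zeroW → u ≡ replicate _ 𝟎

_∈HDual_ : ∀ {k n} → Word n → GenMat k n → Set
x ∈HDual G = ∀ y → y ∈C G → herm x y ≡ 𝟎

HermitianLCD : ∀ {k n} → GenMat k n → Set
HermitianLCD G = ∀ x → x ∈C G → x ∈HDual G → x ≡ zeroW

MinWeight : ∀ {k n} → GenMat k n → ℕ → Set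
MinWeight G d =
  (∀ x → x ∈C G → x ≢ zeroW → d ≤ wt x)
  × (∃ λ x → x ∈C G × x ≢ zeroW × wt x ≡ d)

HLCDCode : ℕ → ℕ → Set
HLCDCode n k = Σ (GenMat k n) λ G → Independent G × HermitianLCD G

D4 : ℕ → ℕ → ℕ → Set
D4 n k d =
  (∃ λ (C : HLCDCode n k) → MinWeight (Data.Product.proj₁ C) d)
  × (∀ (C : HLCDCode n k) (d′ : ℕ) → MinWeight (Data.Product.proj₁ C) d′ → d′ ≤ d)

-- Lower bounds: the 21 points of PG(2,4) as columns give the simplex code, all of
-- whose nonzero codewords have weight 16 and which is Hermitian self-orthogonal.
-- Appending to s copies of it a fixed Hermitian LCD code of length 11, 16 or 20
-- (checked by computation) adds 16s to the minimum weight and keeps the code LCD.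
--
-- Upper bounds: suppose a Hermitian LCD [n,3] code has minimum weight at least
-- D₀ = bound + 1, and let e(P) ≥ 0 be the excess over D₀ of the weight of the
-- codewords at a point P of PG(2,4). Counting the columns of a generator matrix
-- gives Σ e = 16n − 21D₀ (this is < 16, so there is no zero column) and
-- Σ_{P∈L} e(P) ≡ 4n − 5D₀ (mod 4) for every line L. For n = 21s+11 and 21s+16
-- this forces all e(P) to be even; for n = 21s+20 it forces e to be the indicator
-- of a line. Either way the parity of wt(uG) is a function Q(u) satisfying
-- Q(a + lv) = Q(a) + Q(v) for some a ≠ 0 and all v and l ≠ 0. As
-- wt(x + ly) + wt(x) + wt(y) ≡ Tr(⟨x,y⟩ l̄) (mod 2) and the trace form is
-- nondegenerate, aG is Hermitian orthogonal to the whole code: not LCD.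

module Submission where

open import Defs
open import Data.Empty using (⊥; ⊥-elim)
open import Data.Fin using (Fin; zero; suc; punchIn)
import Data.Fin.Properties as Fin
open import Data.Nat using (ℕ; zero; suc; _+_; _*_; _∸_; _≤_; _<_; z≤n; s≤s)
import Data.Nat as ℕ
open import Data.Nat.Divisibility using (_∣_; divides; ∣-trans; m∣m*n; _∣?_; ∣⇒≤; ∣m+n∣m⇒∣n)
open import Data.Nat.Properties hiding (_≟_)
open import Algebra.Properties.Semiring.Sum +-*-semiring
open import Data.Nat.Tactic.RingSolver using (solve-∀)
open import Data.Product using (_×_; _,_; ∃; proj₁; proj₂)
open import Data.Sum using (_⊎_; inj₁; inj₂)
open import Data.Vec using (Vec; []; _∷_; replicate; zipWith; foldr; map; lookup; _++_; concat; transpose)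
open import Data.Vec.Functional using (removeAt)
open import Data.Vec.Properties using (≡-dec; map-replicate; zipWith-is-⊛; map-cong; map-∘; map-++)
open import Function using (_∘_)
open import Relation.Binary.Definitions using (DecidableEquality)
open import Relation.Binary.PropositionalEquality
  using (_≡_; _≢_; refl; sym; trans; cong; cong₂; subst; module ≡-Reasoning)
open import Relation.Nullary using (Dec; yes; no; contradiction)
open import Relation.Nullary.Decidable using (map′; _×-dec_; _⊎-dec_; _→-dec_; ¬?; from-yes; from-no)

-- Decisions by exhaustion over F4

infix 4 _≟_
_≟_ : DecidableEquality F4
𝟎 ≟ 𝟎 = yes refl
𝟎 ≟ 𝟏 = no λ ()
𝟎 ≟ ω = no λ ()
𝟎 ≟ ω² = no λ ()
𝟏 ≟ 𝟎 = no λ ()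
𝟏 ≟ 𝟏 = yes refl
𝟏 ≟ ω = no λ ()
𝟏 ≟ ω² = no λ ()
ω ≟ 𝟎 = no λ ()
ω ≟ 𝟏 = no λ ()
ω ≟ ω = yes refl
ω ≟ ω² = no λ ()
ω² ≟ 𝟎 = no λ ()
ω² ≟ 𝟏 = no λ ()
ω² ≟ ω = no λ ()
ω² ≟ ω² = yes refl

infix 4 _≟ᵥ_
_≟ᵥ_ : ∀ {k} → DecidableEquality (Word k)
_≟ᵥ_ = ≡-dec _≟_

all? : {P : F4 → Set} → ((x : F4) → Dec (P x)) → Dec (∀ x → P x)
all? P? = map′ (λ { (p₀ , p₁ , p₂ , p₃) → λ { 𝟎 → p₀ ; 𝟏 → p₁ ; ω → p₂ ; ω² → p₃ } })
               (λ p → p 𝟎 , p 𝟏 , p ω , p ω²)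
               (P? 𝟎 ×-dec P? 𝟏 ×-dec P? ω ×-dec P? ω²)

any? : {P : F4 → Set} → ((x : F4) → Dec (P x)) → Dec (∃ P)
any? P? = map′ (λ { (inj₁ p) → _ , p ; (inj₂ (inj₁ p)) → _ , p
                  ; (inj₂ (inj₂ (inj₁ p))) → _ , p ; (inj₂ (inj₂ (inj₂ p))) → _ , p })
               (λ { (𝟎 , p) → inj₁ p ; (𝟏 , p) → inj₂ (inj₁ p)
                  ; (ω , p) → inj₂ (inj₂ (inj₁ p)) ; (ω² , p) → inj₂ (inj₂ (inj₂ p)) })
               (P? 𝟎 ⊎-dec P? 𝟏 ⊎-dec P? ω ⊎-dec P? ω²)

allᵥ? : ∀ {k} {P : Word k → Set} → ((v : Word k) → Dec (P v)) → Dec (∀ v → P v)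
allᵥ? {zero}  P? = map′ (λ p → λ { [] → p }) (λ p → p []) (P? [])
allᵥ? {suc k} P? = map′ (λ p → λ { (x ∷ v) → p x v }) (λ p x v → p (x ∷ v))
                        (all? λ x → allᵥ? λ v → P? (x ∷ v))

anyᵥ? : ∀ {k} {P : Word k → Set} → ((v : Word k) → Dec (P v)) → Dec (∃ P)
anyᵥ? {zero}  P? = map′ (λ p → [] , p) (λ { ([] , p) → p }) (P? [])
anyᵥ? {suc k} P? = map′ (λ { (x , v , p) → x ∷ v , p }) (λ { (x ∷ v , p) → x , v , p })
                        (any? λ x → anyᵥ? λ v → P? (x ∷ v))

⊕-assoc : ∀ a b c → (a ⊕ b) ⊕ c ≡ a ⊕ (b ⊕ c)
⊕-assoc = from-yes (all? λ a → all? λ b → all? λ c → (a ⊕ b) ⊕ c ≟ a ⊕ (b ⊕ c))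

⊕-self : ∀ a → a ⊕ a ≡ 𝟎
⊕-self = from-yes (all? λ a → a ⊕ a ≟ 𝟎)

⊕-interchange₃ : ∀ a a′ b b′ c c′ → (a ⊕ a′) ⊕ (b ⊕ b′) ⊕ (c ⊕ c′) ≡ (a ⊕ b ⊕ c) ⊕ (a′ ⊕ b′ ⊕ c′)
⊕-interchange₃ = from-yes (all? λ a → all? λ a′ → all? λ b → all? λ b′ → all? λ c → all? λ c′ →
  (a ⊕ a′) ⊕ (b ⊕ b′) ⊕ (c ⊕ c′) ≟ (a ⊕ b ⊕ c) ⊕ (a′ ⊕ b′ ⊕ c′))

-- Weights and their parities

wt₁ : F4 → ℕ
wt₁ 𝟎 = 0
wt₁ _ = 1

wt-∷ : ∀ {n} x (v : Word n) → wt (x ∷ v) ≡ wt₁ x + wt v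
wt-∷ 𝟎 v = refl
wt-∷ 𝟏 v = refl
wt-∷ ω v = refl
wt-∷ ω² v = refl

wt-++ : ∀ {m n} (x : Word m) (y : Word n) → wt (x ++ y) ≡ wt x + wt y
wt-++ [] y = refl
wt-++ (a ∷ x) y = begin
  wt (a ∷ x ++ y)       ≡⟨ wt-∷ a (x ++ y) ⟩
  wt₁ a + wt (x ++ y)   ≡⟨ cong (wt₁ a +_) (wt-++ x y) ⟩
  wt₁ a + (wt x + wt y) ≡⟨ +-assoc (wt₁ a) (wt x) (wt y) ⟨
  wt₁ a + wt x + wt y   ≡⟨ cong (_+ wt y) (wt-∷ a x) ⟨
  wt (a ∷ x) + wt y     ∎
  where open ≡-Reasoning

wt-zeroW : ∀ n → wt (zeroW {n}) ≡ 0
wt-zeroW zero = refl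
wt-zeroW (suc n) = wt-zeroW n

wt₁-scale : ∀ l x → l ≢ 𝟎 → wt₁ (l ⊗ x) ≡ wt₁ x
wt₁-scale = from-yes (all? λ l → all? λ x → ¬? (l ≟ 𝟎) →-dec wt₁ (l ⊗ x) ℕ.≟ wt₁ x)

wt-scale : ∀ {n} l (x : Word n) → l ≢ 𝟎 → wt (scale l x) ≡ wt x
wt-scale l [] l≢0 = refl
wt-scale l (a ∷ x) l≢0 = begin
  wt (l ⊗ a ∷ scale l x)       ≡⟨ wt-∷ (l ⊗ a) (scale l x) ⟩
  wt₁ (l ⊗ a) + wt (scale l x) ≡⟨ cong₂ _+_ (wt₁-scale l a l≢0) (wt-scale l x l≢0) ⟩
  wt₁ a + wt x                 ≡⟨ wt-∷ a x ⟨
  wt (a ∷ x)                   ∎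
  where open ≡-Reasoning

-- The ring map ℕ → F4: the parity of a number, read in the prime field.
fromℕ : ℕ → F4
fromℕ zero = 𝟎
fromℕ (suc m) = 𝟏 ⊕ fromℕ m

fromℕ-+ : ∀ m n → fromℕ (m + n) ≡ fromℕ m ⊕ fromℕ n
fromℕ-+ zero n = refl
fromℕ-+ (suc m) n = trans (cong (𝟏 ⊕_) (fromℕ-+ m n)) (sym (⊕-assoc 𝟏 (fromℕ m) (fromℕ n)))

fromℕ-even : ∀ {m} → 2 ∣ m → fromℕ m ≡ 𝟎
fromℕ-even (divides q refl) = begin
  fromℕ (q * 2)          ≡⟨ cong fromℕ (*-comm q 2) ⟩
  fromℕ (q + (q + 0))    ≡⟨ fromℕ-+ q (q + 0) ⟩
  fromℕ q ⊕ fromℕ (q + 0) ≡⟨ cong (λ r → fromℕ q ⊕ fromℕ r) (+-identityʳ q) ⟩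
  fromℕ q ⊕ fromℕ q      ≡⟨ ⊕-self (fromℕ q) ⟩
  𝟎                      ∎
  where open ≡-Reasoning

fromℕ-16*+ : ∀ s r → fromℕ (16 * s + r) ≡ fromℕ r
fromℕ-16*+ s r = begin
  fromℕ (16 * s + r)       ≡⟨ fromℕ-+ (16 * s) r ⟩
  fromℕ (16 * s) ⊕ fromℕ r ≡⟨ cong (_⊕ fromℕ r) (fromℕ-even (∣-trans (divides 8 refl) (m∣m*n s))) ⟩
  fromℕ r                  ∎
  where open ≡-Reasoning

fromℕ-wt-∷ : ∀ {n} x (v : Word n) → fromℕ (wt (x ∷ v)) ≡ fromℕ (wt₁ x) ⊕ fromℕ (wt v)
fromℕ-wt-∷ x v = trans (cong fromℕ (wt-∷ x v)) (fromℕ-+ (wt₁ x) (wt v))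

tr : F4 → F4
tr x = x ⊕ conj x

tr-⊕-⊗ : ∀ x y c → tr (x ⊗ c) ⊕ tr (y ⊗ c) ≡ tr ((x ⊕ y) ⊗ c)
tr-⊕-⊗ = from-yes (all? λ x → all? λ y → all? λ c → tr (x ⊗ c) ⊕ tr (y ⊗ c) ≟ tr ((x ⊕ y) ⊗ c))

fromℕ-wt₁-trace : ∀ a b l → l ≢ 𝟎 →
  fromℕ (wt₁ (a ⊕ l ⊗ b)) ⊕ fromℕ (wt₁ a) ⊕ fromℕ (wt₁ b) ≡ tr (a ⊗ conj b ⊗ conj l)
fromℕ-wt₁-trace = from-yes (all? λ a → all? λ b → all? λ l → ¬? (l ≟ 𝟎) →-dec
  fromℕ (wt₁ (a ⊕ l ⊗ b)) ⊕ fromℕ (wt₁ a) ⊕ fromℕ (wt₁ b) ≟ tr (a ⊗ conj b ⊗ conj l))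

fromℕ-wt-trace : ∀ {n} (x y : Word n) l → l ≢ 𝟎 →
  fromℕ (wt (x +W scale l y)) ⊕ fromℕ (wt x) ⊕ fromℕ (wt y) ≡ tr (herm x y ⊗ conj l)
fromℕ-wt-trace [] [] l l≢0 = refl
fromℕ-wt-trace (a ∷ x) (b ∷ y) l l≢0 = begin
  fromℕ (wt (a ⊕ l ⊗ b ∷ x +W scale l y)) ⊕ fromℕ (wt (a ∷ x)) ⊕ fromℕ (wt (b ∷ y))
    ≡⟨ cong₂ _⊕_ (cong₂ _⊕_ (fromℕ-wt-∷ (a ⊕ l ⊗ b) (x +W scale l y)) (fromℕ-wt-∷ a x)) (fromℕ-wt-∷ b y) ⟩
  (fromℕ (wt₁ (a ⊕ l ⊗ b)) ⊕ fromℕ (wt (x +W scale l y))) ⊕ (fromℕ (wt₁ a) ⊕ fromℕ (wt x))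
    ⊕ (fromℕ (wt₁ b) ⊕ fromℕ (wt y))
    ≡⟨ ⊕-interchange₃ (fromℕ (wt₁ (a ⊕ l ⊗ b))) _ (fromℕ (wt₁ a)) _ (fromℕ (wt₁ b)) (fromℕ (wt y)) ⟩
  (fromℕ (wt₁ (a ⊕ l ⊗ b)) ⊕ fromℕ (wt₁ a) ⊕ fromℕ (wt₁ b))
    ⊕ (fromℕ (wt (x +W scale l y)) ⊕ fromℕ (wt x) ⊕ fromℕ (wt y))
    ≡⟨ cong₂ _⊕_ (fromℕ-wt₁-trace a b l l≢0) (fromℕ-wt-trace x y l l≢0) ⟩
  tr (a ⊗ conj b ⊗ conj l) ⊕ tr (herm x y ⊗ conj l)
    ≡⟨ tr-⊕-⊗ (a ⊗ conj b) (herm x y) (conj l) ⟩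
  tr (herm (a ∷ x) (b ∷ y) ⊗ conj l) ∎
  where open ≡-Reasoning

trace-nondegenerate : ∀ t → (∀ l → l ≢ 𝟎 → tr (t ⊗ conj l) ≡ 𝟎) → t ≡ 𝟎
trace-nondegenerate = from-yes (all? λ t → all? (λ l → ¬? (l ≟ 𝟎) →-dec tr (t ⊗ conj l) ≟ 𝟎) →-dec t ≟ 𝟎)

herm-zero-from-parities : ∀ {n} (x y : Word n) →
  (∀ l → l ≢ 𝟎 → fromℕ (wt (x +W scale l y)) ⊕ fromℕ (wt x) ⊕ fromℕ (wt y) ≡ 𝟎) → herm x y ≡ 𝟎
herm-zero-from-parities x y even = trace-nondegenerate (herm x y) λ l l≢0 →
  trans (sym (fromℕ-wt-trace x y l l≢0)) (even l l≢0)

-- Codewords through the columns of a generator matrix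

infixl 7 _·_
_·_ : ∀ {k} → Word k → Word k → F4
u · c = foldr _ _⊕_ 𝟎 (zipWith _⊗_ u c)

⊗-zeroʳ : ∀ l → l ⊗ 𝟎 ≡ 𝟎
⊗-zeroʳ = from-yes (all? λ l → l ⊗ 𝟎 ≟ 𝟎)

·-linear : ∀ {k} (u v c : Word k) l → (u +W scale l v) · c ≡ u · c ⊕ l ⊗ (v · c)
·-linear [] [] [] l = sym (⊗-zeroʳ l)
·-linear (a ∷ u) (b ∷ v) (x ∷ c) l =
  trans (cong ((a ⊕ l ⊗ b) ⊗ x ⊕_) (·-linear u v c l)) (step a b x (u · c) (v · c) l)
  where
  step : ∀ a b x X Y l → (a ⊕ l ⊗ b) ⊗ x ⊕ (X ⊕ l ⊗ Y) ≡ (a ⊗ x ⊕ X) ⊕ l ⊗ (b ⊗ x ⊕ Y)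
  step = from-yes (all? λ a → all? λ b → all? λ x → all? λ X → all? λ Y → all? λ l →
    (a ⊕ l ⊗ b) ⊗ x ⊕ (X ⊕ l ⊗ Y) ≟ (a ⊗ x ⊕ X) ⊕ l ⊗ (b ⊗ x ⊕ Y))

·-scale : ∀ {k} l (v c : Word k) → scale l v · c ≡ l ⊗ (v · c)
·-scale l [] [] = sym (⊗-zeroʳ l)
·-scale l (b ∷ v) (x ∷ c) = trans (cong ((l ⊗ b) ⊗ x ⊕_) (·-scale l v c)) (step l b x (v · c))
  where
  step : ∀ l b x Y → (l ⊗ b) ⊗ x ⊕ l ⊗ Y ≡ l ⊗ (b ⊗ x ⊕ Y)
  step = from-yes (all? λ l → all? λ b → all? λ x → all? λ Y → (l ⊗ b) ⊗ x ⊕ l ⊗ Y ≟ l ⊗ (b ⊗ x ⊕ Y))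

·-zeroˡ : ∀ {k} (c : Word k) → zeroW · c ≡ 𝟎
·-zeroˡ [] = refl
·-zeroˡ (x ∷ c) = ·-zeroˡ c

transpose-∷ : ∀ {A : Set} {m n} (r : Vec A n) (rs : Vec (Vec A n) m) →
  transpose (r ∷ rs) ≡ zipWith _∷_ r (transpose rs)
transpose-∷ r rs = sym (zipWith-is-⊛ _∷_ r (transpose rs))

encode-transpose : ∀ {k n} (G : GenMat k n) u → encode G u ≡ map (u ·_) (transpose G)
encode-transpose [] [] = sym (map-replicate ([] ·_) [] _)
encode-transpose (g ∷ G) (a ∷ u) = begin
  scale a g +W encode G u                       ≡⟨ cong (scale a g +W_) (encode-transpose G u) ⟩
  scale a g +W map (u ·_) (transpose G)         ≡⟨ prepend-row g (transpose G) ⟩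
  map ((a ∷ u) ·_) (zipWith _∷_ g (transpose G)) ≡⟨ cong (map ((a ∷ u) ·_)) (transpose-∷ g G) ⟨
  map ((a ∷ u) ·_) (transpose (g ∷ G))          ∎
  where
  open ≡-Reasoning
  prepend-row : ∀ {n} (g : Word n) cs → scale a g +W map (u ·_) cs ≡ map ((a ∷ u) ·_) (zipWith _∷_ g cs)
  prepend-row [] [] = refl
  prepend-row (x ∷ g) (c ∷ cs) = cong (_ ∷_) (prepend-row g cs)

encode-zipWith-∷ : ∀ {k n} (c : Word k) (M : GenMat k n) u → encode (zipWith _∷_ c M) u ≡ u · c ∷ encode M u
encode-zipWith-∷ [] [] [] = refl
encode-zipWith-∷ (x ∷ c) (g ∷ M) (a ∷ u) = cong (scale a (x ∷ g) +W_) (encode-zipWith-∷ c M u)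

encode-transposed : ∀ {k n} (cs : Vec (Word k) n) u → encode (transpose cs) u ≡ map (u ·_) cs
encode-transposed [] u with encode (transpose []) u
... | [] = refl
encode-transposed (c ∷ cs) u = begin
  encode (transpose (c ∷ cs)) u          ≡⟨ cong (λ M → encode M u) (transpose-∷ c cs) ⟩
  encode (zipWith _∷_ c (transpose cs)) u ≡⟨ encode-zipWith-∷ c (transpose cs) u ⟩
  u · c ∷ encode (transpose cs) u         ≡⟨ cong (u · c ∷_) (encode-transposed cs u) ⟩
  u · c ∷ map (u ·_) cs                   ∎
  where open ≡-Reasoning

map-·-linear : ∀ {k n} (cs : Vec (Word k) n) u v l →
  map ((u +W scale l v) ·_) cs ≡ map (u ·_) cs +W scale l (map (v ·_) cs)
map-·-linear [] u v l = refl
map-·-linear (c ∷ cs) u v l = cong₂ _∷_ (·-linear u v c l) (map-·-linear cs u v l)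

encode-linear : ∀ {k n} (G : GenMat k n) u v l → encode G (u +W scale l v) ≡ encode G u +W scale l (encode G v)
encode-linear G u v l = begin
  encode G (u +W scale l v)                                    ≡⟨ encode-transpose G (u +W scale l v) ⟩
  map ((u +W scale l v) ·_) (transpose G)                      ≡⟨ map-·-linear (transpose G) u v l ⟩
  map (u ·_) (transpose G) +W scale l (map (v ·_) (transpose G)) ≡⟨ cong₂ (λ x y → x +W scale l y) (encode-transpose G u) (encode-transpose G v) ⟨
  encode G u +W scale l (encode G v)                           ∎
  where open ≡-Reasoning

encode-zero : ∀ {k n} (G : GenMat k n) → encode G zeroW ≡ zeroW
encode-zero [] = refl
encode-zero (g ∷ G) = trans (cong (scale 𝟎 g +W_) (encode-zero G)) (scale-𝟎 g)
  where
  scale-𝟎 : ∀ {n} (g : Word n) → scale 𝟎 g +W zeroW ≡ zeroW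
  scale-𝟎 [] = refl
  scale-𝟎 (x ∷ g) = cong (𝟎 ∷_) (scale-𝟎 g)

herm-zeroˡ : ∀ {n} (y : Word n) → herm zeroW y ≡ 𝟎
herm-zeroˡ [] = refl
herm-zeroˡ (b ∷ y) = herm-zeroˡ y

ParityRadical : ∀ {k} → (Word k → F4) → Word k → Set
ParityRadical Q a = ∀ v l → l ≢ 𝟎 → Q (a +W scale l v) ⊕ Q a ⊕ Q v ≡ 𝟎

LCD-radical-trivial : ∀ {k n} (G : GenMat k n) → Independent G → HermitianLCD G →
  (Q : Word k → F4) → (∀ u → fromℕ (wt (encode G u)) ≡ Q u) → ∀ a → ParityRadical Q a → a ≡ zeroW
LCD-radical-trivial G indep lcd Q parity a radical = indep a (lcd (encode G a) (a , refl) orthogonal)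
  where
  orthogonal : encode G a ∈HDual G
  orthogonal _ (v , refl) = herm-zero-from-parities (encode G a) (encode G v) λ l l≢0 → begin
    fromℕ (wt (encode G a +W scale l (encode G v))) ⊕ fromℕ (wt (encode G a)) ⊕ fromℕ (wt (encode G v))
      ≡⟨ cong (λ x → fromℕ (wt x) ⊕ _ ⊕ _) (encode-linear G a v l) ⟨
    fromℕ (wt (encode G (a +W scale l v))) ⊕ fromℕ (wt (encode G a)) ⊕ fromℕ (wt (encode G v))
      ≡⟨ cong₂ _⊕_ (cong₂ _⊕_ (parity (a +W scale l v)) (parity a)) (parity v) ⟩
    Q (a +W scale l v) ⊕ Q a ⊕ Q v
      ≡⟨ radical v l l≢0 ⟩
    𝟎 ∎
    where open ≡-Reasoning

∑-const : ∀ n k → ∑[ i < n ] k ≡ n * k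
∑-const zero k = refl
∑-const (suc n) k = cong (k +_) (∑-const n k)

∑-mono-≤ : ∀ {n} {f g : Fin n → ℕ} → (∀ i → f i ≤ g i) → sum f ≤ sum g
∑-mono-≤ {zero} f≤g = z≤n
∑-mono-≤ {suc n} f≤g = +-mono-≤ (f≤g zero) (∑-mono-≤ (f≤g ∘ suc))

∑-tight : ∀ {n} {f g : Fin n → ℕ} → (∀ i → f i ≤ g i) → sum f ≡ sum g → ∀ i → f i ≡ g i
∑-tight {suc n} {f} {g} f≤g ∑f≡∑g with m≤n⇒m<n∨m≡n (f≤g zero)
... | inj₁ f₀<g₀ = contradiction ∑f≡∑g (<⇒≢ (+-mono-<-≤ f₀<g₀ (∑-mono-≤ (f≤g ∘ suc))))
... | inj₂ f₀≡g₀ = λ { zero → f₀≡g₀ ; (suc i) → ∑-tight (f≤g ∘ suc) rest≡ i }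
  where
  rest≡ : sum (f ∘ suc) ≡ sum (g ∘ suc)
  rest≡ = +-cancelˡ-≡ (f zero) _ _ (trans ∑f≡∑g (cong (_+ sum (g ∘ suc)) (sym f₀≡g₀)))

∑-positive : ∀ {n} (f : Fin n → ℕ) → 1 ≤ sum f → ∃ λ i → 1 ≤ f i
∑-positive {suc n} f 1≤∑ with f zero in f₀≡
... | suc _ = zero , subst (1 ≤_) (sym f₀≡) (s≤s z≤n)
... | zero with ∑-positive (f ∘ suc) 1≤∑
...   | i , 1≤fi = suc i , 1≤fi

∑-zero-or-≥ : ∀ {n m} (f : Fin n → ℕ) → (∀ i → f i ≡ 0 ⊎ m ≤ f i) → sum f ≡ 0 ⊎ m ≤ sum f
∑-zero-or-≥ {zero} f h = inj₁ refl
∑-zero-or-≥ {suc n} {m} f h with h zero | ∑-zero-or-≥ (f ∘ suc) (h ∘ suc)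
... | _          | inj₂ m≤rest = inj₂ (≤-trans m≤rest (m≤n+m _ (f zero)))
... | inj₂ m≤f₀ | inj₁ _     = inj₂ (≤-trans m≤f₀ (m≤m+n (f zero) _))
... | inj₁ f₀≡0 | inj₁ rest≡0 = inj₁ (cong₂ _+_ f₀≡0 rest≡0)

δ : ∀ {n} → Fin n → Fin n → ℕ
δ zero zero = 1
δ zero (suc _) = 0
δ (suc _) zero = 0
δ (suc i) (suc j) = δ i j

∑-δ : ∀ {n} i (f : Fin n → ℕ) → ∑[ j < n ] (δ i j * f j) ≡ f i
∑-δ {suc n} zero f = trans (cong₂ _+_ (+-identityʳ (f zero)) (trans (∑-const n 0) (*-zeroʳ n))) (+-identityʳ (f zero))
∑-δ {suc n} (suc i) f = ∑-δ i (f ∘ suc)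

∑-*-shift : ∀ {n} (g f : Fin n → ℕ) D → ∑[ i < n ] (g i * (D + f i)) ≡ sum g * D + ∑[ i < n ] (g i * f i)
∑-*-shift g f D = begin
  ∑[ i < _ ] (g i * (D + f i))                 ≡⟨ sum-cong-≗ (λ i → *-distribˡ-+ (g i) D (f i)) ⟩
  ∑[ i < _ ] (g i * D + g i * f i)             ≡⟨ ∑-distrib-+ (λ i → g i * D) (λ i → g i * f i) ⟩
  ∑[ i < _ ] (g i * D) + ∑[ i < _ ] (g i * f i) ≡⟨ cong (_+ ∑[ i < _ ] (g i * f i)) (*-distribʳ-sum D g) ⟨
  sum g * D + ∑[ i < _ ] (g i * f i)           ∎
  where open ≡-Reasoning

wt-map : ∀ {A : Set} {n} (f : A → F4) (xs : Vec A n) → wt (map f xs) ≡ ∑[ j < n ] wt₁ (f (lookup xs j))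
wt-map f [] = refl
wt-map f (x ∷ xs) = trans (wt-∷ (f x) (map f xs)) (cong (wt₁ (f x) +_) (wt-map f xs))

-- Z counts the indices where F vanishes.
count-two-valued : ∀ {n} m (F : Fin n → ℕ) → (∀ j → F j ≡ 0 ⊎ F j ≡ m) → ∃ λ Z → sum F + m * Z ≡ m * n
count-two-valued {zero} m F two-valued = 0 , refl
count-two-valued {suc n} m F two-valued with count-two-valued m (F ∘ suc) (two-valued ∘ suc) | two-valued zero
... | Z , eq | inj₁ F₀≡0 = suc Z , (begin
  F zero + sum (F ∘ suc) + m * suc Z ≡⟨ cong (λ x → x + sum (F ∘ suc) + m * suc Z) F₀≡0 ⟩
  sum (F ∘ suc) + m * suc Z          ≡⟨ shuffle (sum (F ∘ suc)) m Z ⟩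
  m + (sum (F ∘ suc) + m * Z)        ≡⟨ cong (m +_) eq ⟩
  m + m * n                          ≡⟨ *-suc m n ⟨
  m * suc n                          ∎)
  where
  open ≡-Reasoning
  shuffle : ∀ r m Z → r + m * suc Z ≡ m + (r + m * Z)
  shuffle = solve-∀
... | Z , eq | inj₂ F₀≡m = Z , (begin
  F zero + sum (F ∘ suc) + m * Z ≡⟨ cong (λ x → x + sum (F ∘ suc) + m * Z) F₀≡m ⟩
  m + sum (F ∘ suc) + m * Z      ≡⟨ +-assoc m (sum (F ∘ suc)) (m * Z) ⟩
  m + (sum (F ∘ suc) + m * Z)    ≡⟨ cong (m +_) eq ⟩
  m + m * n                      ≡⟨ *-suc m n ⟨
  m * suc n                      ∎)
  where open ≡-Reasoning

weighted-weight-count : ∀ {k n p} (pt : Fin p → Word k) (g : Fin p → ℕ) m (cs : Vec (Word k) n) →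
  (∀ c → ∑[ P < p ] (g P * wt₁ (pt P · c)) ≡ 0 ⊎ ∑[ P < p ] (g P * wt₁ (pt P · c)) ≡ m) →
  ∃ λ Z → ∑[ P < p ] (g P * wt (map (pt P ·_) cs)) + m * Z ≡ m * n
weighted-weight-count {n = n} {p} pt g m cs two-valued =
  subst (λ x → ∃ λ Z → x + m * Z ≡ m * n) (sym interchange) (count-two-valued m _ (two-valued ∘ lookup cs))
  where
  open ≡-Reasoning
  interchange : ∑[ P < p ] (g P * wt (map (pt P ·_) cs)) ≡ ∑[ j < n ] ∑[ P < p ] (g P * wt₁ (pt P · lookup cs j))
  interchange = begin
    ∑[ P < p ] (g P * wt (map (pt P ·_) cs))               ≡⟨ sum-cong-≗ (λ P → cong (g P *_) (wt-map (pt P ·_) cs)) ⟩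
    ∑[ P < p ] (g P * ∑[ j < n ] wt₁ (pt P · lookup cs j)) ≡⟨ sum-cong-≗ (λ P → *-distribˡ-sum (g P) (λ j → wt₁ (pt P · lookup cs j))) ⟩
    ∑[ P < p ] ∑[ j < n ] (g P * wt₁ (pt P · lookup cs j)) ≡⟨ ∑-comm (λ P j → g P * wt₁ (pt P · lookup cs j)) ⟩
    ∑[ j < n ] ∑[ P < p ] (g P * wt₁ (pt P · lookup cs j)) ∎

-- The projective plane PG(2,4)

Point Line : Set
Point = Fin 21
Line = Fin 21

-- One representative of each one-dimensional subspace of F4³.
points : Vec (Word 3) 21
points =
  (𝟎 ∷ 𝟎 ∷ 𝟏 ∷ []) ∷ (𝟎 ∷ 𝟏 ∷ 𝟎 ∷ []) ∷ (𝟎 ∷ 𝟏 ∷ 𝟏 ∷ []) ∷ (𝟎 ∷ 𝟏 ∷ ω ∷ []) ∷ (𝟎 ∷ 𝟏 ∷ ω² ∷ []) ∷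
  (𝟏 ∷ 𝟎 ∷ 𝟎 ∷ []) ∷ (𝟏 ∷ 𝟎 ∷ 𝟏 ∷ []) ∷ (𝟏 ∷ 𝟎 ∷ ω ∷ []) ∷ (𝟏 ∷ 𝟎 ∷ ω² ∷ []) ∷
  (𝟏 ∷ 𝟏 ∷ 𝟎 ∷ []) ∷ (𝟏 ∷ 𝟏 ∷ 𝟏 ∷ []) ∷ (𝟏 ∷ 𝟏 ∷ ω ∷ []) ∷ (𝟏 ∷ 𝟏 ∷ ω² ∷ []) ∷
  (𝟏 ∷ ω ∷ 𝟎 ∷ []) ∷ (𝟏 ∷ ω ∷ 𝟏 ∷ []) ∷ (𝟏 ∷ ω ∷ ω ∷ []) ∷ (𝟏 ∷ ω ∷ ω² ∷ []) ∷
  (𝟏 ∷ ω² ∷ 𝟎 ∷ []) ∷ (𝟏 ∷ ω² ∷ 𝟏 ∷ []) ∷ (𝟏 ∷ ω² ∷ ω ∷ []) ∷ (𝟏 ∷ ω² ∷ ω² ∷ []) ∷ []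

point : Point → Word 3
point = lookup points

-- A line is named by a normal vector: L passes through P iff point P · point L ≡ 𝟎.
χ : Line → Point → ℕ
χ L P = 1 ∸ wt₁ (point P · point L)

χ≤1 : ∀ L P → χ L P ≤ 1
χ≤1 L P = m∸n≤m 1 (wt₁ (point P · point L))

χ-0-or-1 : ∀ L P → χ L P ≡ 0 ⊎ χ L P ≡ 1
χ-0-or-1 L P with point P · point L
... | 𝟎 = inj₂ refl
... | 𝟏 = inj₁ refl
... | ω = inj₁ refl
... | ω² = inj₁ refl

χ*≤ : ∀ (f : Point → ℕ) L P → χ L P * f P ≤ f P
χ*≤ f L P = ≤-trans (*-monoˡ-≤ (f P) (χ≤1 L P)) (≤-reflexive (*-identityˡ (f P)))

lineSum : Line → (Point → ℕ) → ℕ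
lineSum L f = ∑[ P < 21 ] (χ L P * f P)

-- Checked by evaluation. Opaque, so that type checking never unfolds the
-- closed decision procedures again.
opaque
  point≢0 : ∀ P → point P ≢ zeroW
  point≢0 = from-yes (Fin.all? λ P → ¬? (point P ≟ᵥ zeroW))

  projective-class : ∀ u → u ≢ zeroW → ∃ λ c → ∃ λ P → c ≢ 𝟎 × u ≡ scale c (point P)
  projective-class = from-yes (allᵥ? λ u → ¬? (u ≟ᵥ zeroW) →-dec
    any? λ c → Fin.any? λ P → ¬? (c ≟ 𝟎) ×-dec u ≟ᵥ scale c (point P))

  points-on-line : ∀ L → sum (χ L) ≡ 5
  points-on-line = from-yes (Fin.all? λ L → sum (χ L) ℕ.≟ 5)

  lines-through-point : ∀ P → ∑[ L < 21 ] χ L P ≡ 5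
  lines-through-point = from-yes (Fin.all? λ P → ∑[ L < 21 ] χ L P ℕ.≟ 5)

  line-missing : ∀ P → ∃ λ L → χ L P ≡ 0
  line-missing = from-yes (Fin.all? λ P → Fin.any? λ L → χ L P ℕ.≟ 0)

  point-on-line : ∀ L → ∃ λ P → point P · point L ≡ 𝟎
  point-on-line = from-yes (Fin.all? λ L → Fin.any? λ P → point P · point L ≟ 𝟎)

  -- Two distinct points span exactly one line, and five lines pass through a point.
  pencil-incidence : ∀ P Q → ∑[ L < 21 ] (χ L P * χ L Q) ≡ 1 + 4 * δ P Q
  pencil-incidence = from-yes (Fin.all? λ P → Fin.all? λ Q → ∑[ L < 21 ] (χ L P * χ L Q) ℕ.≟ 1 + 4 * δ P Q)

  -- A column c ≢ 0 is orthogonal to exactly 5 of the 21 points.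
  column-weight-on-points : ∀ c → ∑[ P < 21 ] (1 * wt₁ (point P · c)) ≡ 0 ⊎ ∑[ P < 21 ] (1 * wt₁ (point P · c)) ≡ 16
  column-weight-on-points = from-yes (allᵥ? λ c →
    ∑[ P < 21 ] (1 * wt₁ (point P · c)) ℕ.≟ 0 ⊎-dec ∑[ P < 21 ] (1 * wt₁ (point P · c)) ℕ.≟ 16)

  -- A column is orthogonal to exactly 1 or to all 5 points of a line.
  column-weight-on-line : ∀ L c → ∑[ P < 21 ] (χ L P * wt₁ (point P · c)) ≡ 0 ⊎ ∑[ P < 21 ] (χ L P * wt₁ (point P · c)) ≡ 4
  column-weight-on-line = from-yes (Fin.all? λ L → allᵥ? λ c →
    ∑[ P < 21 ] (χ L P * wt₁ (point P · c)) ℕ.≟ 0 ⊎-dec ∑[ P < 21 ] (χ L P * wt₁ (point P · c)) ℕ.≟ 4)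

pencil-sum : ∀ (f : Point → ℕ) P → ∑[ L < 21 ] (χ L P * lineSum L f) ≡ sum f + 4 * f P
pencil-sum f P = begin
  ∑[ L < 21 ] (χ L P * lineSum L f)                  ≡⟨ sum-cong-≗ (λ L → *-distribˡ-sum (χ L P) (λ Q → χ L Q * f Q)) ⟩
  ∑[ L < 21 ] ∑[ Q < 21 ] (χ L P * (χ L Q * f Q))     ≡⟨ ∑-comm (λ L Q → χ L P * (χ L Q * f Q)) ⟩
  ∑[ Q < 21 ] ∑[ L < 21 ] (χ L P * (χ L Q * f Q))     ≡⟨ sum-cong-≗ regroup ⟩
  ∑[ Q < 21 ] (∑[ L < 21 ] (χ L P * χ L Q) * f Q)     ≡⟨ sum-cong-≗ (λ Q → cong (_* f Q) (pencil-incidence P Q)) ⟩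
  ∑[ Q < 21 ] ((1 + 4 * δ P Q) * f Q)                 ≡⟨ sum-cong-≗ (λ Q → expand (δ P Q) (f Q)) ⟩
  ∑[ Q < 21 ] (f Q + 4 * (δ P Q * f Q))               ≡⟨ ∑-distrib-+ f (λ Q → 4 * (δ P Q * f Q)) ⟩
  sum f + ∑[ Q < 21 ] (4 * (δ P Q * f Q))             ≡⟨ cong (sum f +_) (*-distribˡ-sum 4 (λ Q → δ P Q * f Q)) ⟨
  sum f + 4 * ∑[ Q < 21 ] (δ P Q * f Q)               ≡⟨ cong (λ x → sum f + 4 * x) (∑-δ P f) ⟩
  sum f + 4 * f P                                     ∎
  where
  open ≡-Reasoning
  regroup : ∀ Q → ∑[ L < 21 ] (χ L P * (χ L Q * f Q)) ≡ ∑[ L < 21 ] (χ L P * χ L Q) * f Q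
  regroup Q = trans (sum-cong-≗ λ L → sym (*-assoc (χ L P) (χ L Q) (f Q)))
                    (sym (*-distribʳ-sum (f Q) (λ L → χ L P * χ L Q)))
  expand : ∀ d x → (1 + 4 * d) * x ≡ x + 4 * (d * x)
  expand = solve-∀

pencil-const : ∀ P a → ∑[ L < 21 ] (χ L P * a) ≡ 5 * a
pencil-const P a = trans (sym (*-distribʳ-sum a (λ L → χ L P))) (cong (_* a) (lines-through-point P))

pencil-mono : ∀ P {g h : Line → ℕ} → (∀ L → χ L P ≡ 1 → g L ≤ h L) →
  ∑[ L < 21 ] (χ L P * g L) ≤ ∑[ L < 21 ] (χ L P * h L)
pencil-mono P g≤h = ∑-mono-≤ termwise
  where
  termwise : ∀ L → χ L P * _ ≤ χ L P * _
  termwise L with χ-0-or-1 L P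
  ... | inj₁ χ≡0 rewrite χ≡0 = z≤n
  ... | inj₂ χ≡1 = *-monoʳ-≤ (χ L P) (g≤h L χ≡1)

pencil-lower-bound : ∀ (f : Point → ℕ) P a → (∀ L → χ L P ≡ 1 → a ≤ lineSum L f) → 5 * a ≤ sum f + 4 * f P
pencil-lower-bound f P a bound = begin
  5 * a                             ≡⟨ pencil-const P a ⟨
  ∑[ L < 21 ] (χ L P * a)           ≤⟨ pencil-mono P bound ⟩
  ∑[ L < 21 ] (χ L P * lineSum L f) ≡⟨ pencil-sum f P ⟩
  sum f + 4 * f P                   ∎
  where open ≤-Reasoning

pencil-upper-bound : ∀ (f : Point → ℕ) P a → (∀ L → χ L P ≡ 1 → lineSum L f ≤ a) → sum f + 4 * f P ≤ 5 * a
pencil-upper-bound f P a bound = begin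
  sum f + 4 * f P                   ≡⟨ pencil-sum f P ⟨
  ∑[ L < 21 ] (χ L P * lineSum L f) ≤⟨ pencil-mono P bound ⟩
  ∑[ L < 21 ] (χ L P * a)           ≡⟨ pencil-const P a ⟩
  5 * a                             ∎
  where open ≤-Reasoning

lineSum≤sum : ∀ (f : Point → ℕ) L → lineSum L f ≤ sum f
lineSum≤sum f L = ∑-mono-≤ λ P → χ*≤ f L P

lineSum-remove : ∀ (f : Point → ℕ) L P → lineSum L f ≡ χ L P * f P + sum (removeAt (λ Q → χ L Q * f Q) P)
lineSum-remove f L P = sum-remove {i = P} (λ Q → χ L Q * f Q)

lineSum-through : ∀ (f : Point → ℕ) L P → χ L P ≡ 1 → lineSum L f ≡ f P + sum (removeAt (λ Q → χ L Q * f Q) P)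
lineSum-through f L P χ≡1 = trans (lineSum-remove f L P) (cong (_+ rest) (trans (cong (_* f P) χ≡1) (*-identityˡ (f P))))
  where
  rest : ℕ
  rest = sum (removeAt (λ Q → χ L Q * f Q) P)

entry≤lineSum : ∀ (f : Point → ℕ) L P → χ L P ≡ 1 → f P ≤ lineSum L f
entry≤lineSum f L P χ≡1 = subst (f P ≤_) (sym (lineSum-through f L P χ≡1)) (m≤m+n (f P) _)

entry+lineSum≤sum : ∀ (f : Point → ℕ) L P → χ L P ≡ 0 → f P + lineSum L f ≤ sum f
entry+lineSum≤sum f L P χ≡0 = begin
  f P + lineSum L f                ≡⟨ cong (f P +_) (lineSum-remove f L P) ⟩
  f P + (χ L P * f P + rest)       ≡⟨ cong (λ x → f P + (x * f P + rest)) χ≡0 ⟩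
  f P + rest                       ≤⟨ +-monoʳ-≤ (f P) (∑-mono-≤ λ j → χ*≤ f L (punchIn P j)) ⟩
  f P + sum (removeAt f P)         ≡⟨ sum-remove {i = P} f ⟨
  sum f                            ∎
  where
  open ≤-Reasoning
  rest : ℕ
  rest = sum (removeAt (λ Q → χ L Q * f Q) P)

-- Distributions on PG(2,4) with prescribed line sums modulo 4

divisor≤ : ∀ {m n} → m ∣ n → 1 ≤ n → m ≤ n
divisor≤ m∣n 1≤n = ∣⇒≤ ⦃ ℕ.>-nonZero 1≤n ⦄ m∣n

χ-scaled : ∀ {m} L P x → x ≡ 0 ⊎ m ≤ x → χ L P * x ≡ 0 ⊎ m ≤ χ L P * x
χ-scaled L P x h with χ-0-or-1 L P
... | inj₁ χ≡0 rewrite χ≡0 = inj₁ refl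
... | inj₂ χ≡1 rewrite χ≡1 | +-identityʳ x = h

excess-even : (e : Point → ℕ) → sum e ≤ 8 → (∀ L → 4 ∣ lineSum L e) → ∀ P → 2 ∣ e P
excess-even e total≤8 lines P with 2 ∣? e P
... | yes even = even
... | no odd = ⊥-elim (m+1+n≰m (8 + 4 * e P) (begin
  8 + 4 * e P + suc (e P + 6) ≡⟨ rearrange (e P) ⟩
  5 * (e P + 3)               ≤⟨ pencil-lower-bound e P (e P + 3) rest≥3 ⟩
  sum e + 4 * e P             ≤⟨ +-monoˡ-≤ (4 * e P) total≤8 ⟩
  8 + 4 * e P                 ∎))
  where
  open ≤-Reasoning
  rearrange : ∀ x → 8 + 4 * x + suc (x + 6) ≡ 5 * (x + 3)
  rearrange = solve-∀
  -- A positive value forces the five lines through its point up to sum ≥ 4.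
  zero-or-≥3 : ∀ Q → e Q ≡ 0 ⊎ 3 ≤ e Q
  zero-or-≥3 Q with e Q ℕ.≟ 0
  ... | yes e≡0 = inj₁ e≡0
  ... | no e≢0 = inj₂ (*-cancelˡ-≤ 4 (+-cancelˡ-≤ 8 12 (4 * e Q) (begin
    5 * 4           ≤⟨ pencil-lower-bound e Q 4 line≥4 ⟩
    sum e + 4 * e Q ≤⟨ +-monoˡ-≤ (4 * e Q) total≤8 ⟩
    8 + 4 * e Q     ∎)))
    where
    line≥4 : ∀ L → χ L Q ≡ 1 → 4 ≤ lineSum L e
    line≥4 L χ≡1 = divisor≤ (lines L) (≤-trans (n≢0⇒n>0 e≢0) (entry≤lineSum e L Q χ≡1))
  weighted-zero-or-≥3 : ∀ L Q → χ L Q * e Q ≡ 0 ⊎ 3 ≤ χ L Q * e Q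
  weighted-zero-or-≥3 L Q = χ-scaled L Q (e Q) (zero-or-≥3 Q)
  -- On a line through P, the other points carry a positive amount since e P is odd.
  rest≥3 : ∀ L → χ L P ≡ 1 → e P + 3 ≤ lineSum L e
  rest≥3 L χ≡1 with ∑-zero-or-≥ (removeAt (λ Q → χ L Q * e Q) P) (weighted-zero-or-≥3 L ∘ punchIn P)
  ... | inj₂ 3≤rest = subst (e P + 3 ≤_) (sym (lineSum-through e L P χ≡1)) (+-monoʳ-≤ (e P) 3≤rest)
  ... | inj₁ rest≡0 = contradiction (∣-trans (divides 2 refl) (subst (4 ∣_) lineSum≡ (lines L))) odd
    where
    lineSum≡ : lineSum L e ≡ e P
    lineSum≡ = trans (lineSum-through e L P χ≡1) (trans (cong (e P +_) rest≡0) (+-identityʳ (e P)))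

one-or-five : ∀ S → 4 ∣ S + 3 → S ≤ 5 → S ≡ 1 ⊎ S ≡ 5
one-or-five 0 4∣ _ = contradiction 4∣ (from-no (4 ∣? 3))
one-or-five 1 _ _ = inj₁ refl
one-or-five 2 4∣ _ = contradiction 4∣ (from-no (4 ∣? 5))
one-or-five 3 4∣ _ = contradiction 4∣ (from-no (4 ∣? 6))
one-or-five 4 4∣ _ = contradiction 4∣ (from-no (4 ∣? 7))
one-or-five 5 _ _ = inj₂ refl
one-or-five (suc (suc (suc (suc (suc (suc _)))))) _ (s≤s (s≤s (s≤s (s≤s (s≤s ())))))

excess-line : (e : Point → ℕ) → sum e ≡ 5 → (∀ L → 4 ∣ lineSum L e + 3) → ∃ λ L → ∀ P → e P ≡ χ L P
excess-line e total≡5 lines =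
  let P₀ , e≡1 = heavy-point
      L , ≡5 = heavy-line P₀ e≡1
  in L , full-line L ≡5
  where
  open ≤-Reasoning
  lineSum-1-or-5 : ∀ L → lineSum L e ≡ 1 ⊎ lineSum L e ≡ 5
  lineSum-1-or-5 L = one-or-five (lineSum L e) (lines L) (subst (lineSum L e ≤_) total≡5 (lineSum≤sum e L))

  -- A value ≥ 2 at P makes every line through P full, leaving nothing for a line missing P.
  e≤1 : ∀ P → e P ≤ 1
  e≤1 P with 2 ℕ.≤? e P
  ... | no e≱2 = ≤-pred (≰⇒> e≱2)
  ... | yes 2≤e with line-missing P
  ...   | L₀ , χ≡0 = ⊥-elim (m+1+n≰m 5 (begin
    5 + 1                 ≤⟨ +-mono-≤ e≥5 (1≤lineSum L₀) ⟩
    e P + lineSum L₀ e    ≤⟨ entry+lineSum≤sum e L₀ P χ≡0 ⟩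
    sum e                 ≡⟨ total≡5 ⟩
    5                     ∎))
    where
    1≤lineSum : ∀ L → 1 ≤ lineSum L e
    1≤lineSum L with lineSum-1-or-5 L
    ... | inj₁ ≡1 = ≤-reflexive (sym ≡1)
    ... | inj₂ ≡5 = subst (1 ≤_) (sym ≡5) (s≤s z≤n)
    full : ∀ L → χ L P ≡ 1 → 5 ≤ lineSum L e
    full L χ≡1 with lineSum-1-or-5 L
    ... | inj₂ ≡5 = ≤-reflexive (sym ≡5)
    ... | inj₁ ≡1 = contradiction (≤-trans 2≤e (subst (e P ≤_) ≡1 (entry≤lineSum e L P χ≡1))) λ { (s≤s ()) }
    e≥5 : 5 ≤ e P
    e≥5 = *-cancelˡ-≤ 4 (+-cancelˡ-≤ 5 20 (4 * e P) (begin
      5 * 5           ≤⟨ pencil-lower-bound e P 5 full ⟩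
      sum e + 4 * e P ≡⟨ cong (_+ 4 * e P) total≡5 ⟩
      5 + 4 * e P     ∎))

  heavy-point : ∃ λ P → e P ≡ 1
  heavy-point with ∑-positive e (subst (1 ≤_) (sym total≡5) (s≤s z≤n))
  ... | P , 1≤e = P , ≤-antisym (e≤1 P) 1≤e

  -- The pencil through a point of value 1 must contain a line of sum 5.
  heavy-line : ∀ P₀ → e P₀ ≡ 1 → ∃ λ L → lineSum L e ≡ 5
  heavy-line P₀ e≡1 with Fin.any? (λ L → (χ L P₀ ℕ.≟ 1) ×-dec (lineSum L e ℕ.≟ 5))
  ... | yes (L , _ , ≡5) = L , ≡5
  ... | no no-full = ⊥-elim (m+1+n≰m 5 (begin
    5 + 4 * 1                  ≡⟨ cong (λ x → 5 + 4 * x) e≡1 ⟨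
    5 + 4 * e P₀               ≡⟨ cong (_+ 4 * e P₀) total≡5 ⟨
    sum e + 4 * e P₀           ≤⟨ pencil-upper-bound e P₀ 1 thin ⟩
    5 * 1                      ∎))
    where
    thin : ∀ L → χ L P₀ ≡ 1 → lineSum L e ≤ 1
    thin L χ≡1 with lineSum-1-or-5 L
    ... | inj₁ ≡1 = ≤-reflexive ≡1
    ... | inj₂ ≡5 = contradiction (L , χ≡1 , ≡5) no-full

  full-line : ∀ L → lineSum L e ≡ 5 → ∀ P → e P ≡ χ L P
  full-line L ≡5 P = trans (sym (off-line P)) (on-line P)
    where
    off-line : ∀ P → χ L P * e P ≡ e P
    off-line = ∑-tight (χ*≤ e L) (trans ≡5 (sym total≡5))
    on-line : ∀ P → χ L P * e P ≡ χ L P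
    on-line = ∑-tight (λ P → ≤-trans (*-monoʳ-≤ (χ L P) (e≤1 P)) (≤-reflexive (*-identityʳ (χ L P))))
                      (trans ≡5 (sym (points-on-line L)))

-- Upper bounds

module CodeWeights {n} (G : GenMat 3 n) where

  W : Word 3 → ℕ
  W u = wt (encode G u)

  W-zero : W zeroW ≡ 0
  W-zero = trans (cong wt (encode-zero G)) (wt-zeroW n)

  W-scale : ∀ c u → c ≢ 𝟎 → W (scale c u) ≡ W u
  W-scale c u c≢0 = begin
    wt (encode G (scale c u))                ≡⟨ cong wt (encode-transpose G (scale c u)) ⟩
    wt (map (scale c u ·_) (transpose G))    ≡⟨ cong wt (map-cong (·-scale c u) (transpose G)) ⟩
    wt (map ((c ⊗_) ∘ (u ·_)) (transpose G)) ≡⟨ cong wt (map-∘ (c ⊗_) (u ·_) (transpose G)) ⟩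
    wt (scale c (map (u ·_) (transpose G)))  ≡⟨ wt-scale c (map (u ·_) (transpose G)) c≢0 ⟩
    wt (map (u ·_) (transpose G))            ≡⟨ cong wt (encode-transpose G u) ⟨
    wt (encode G u)                          ∎
    where open ≡-Reasoning

  weighted-W-count : ∀ (g : Point → ℕ) m →
    (∀ c → ∑[ P < 21 ] (g P * wt₁ (point P · c)) ≡ 0 ⊎ ∑[ P < 21 ] (g P * wt₁ (point P · c)) ≡ m) →
    ∃ λ Z → ∑[ P < 21 ] (g P * W (point P)) + m * Z ≡ m * n
  weighted-W-count g m two-valued =
    subst (λ x → ∃ λ Z → x + m * Z ≡ m * n)
          (sum-cong-≗ λ P → cong (λ x → g P * wt x) (sym (encode-transpose G (point P))))
          (weighted-weight-count point g m (transpose G) two-valued)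

excess-cancel : ∀ {E Z K} → E + 16 * Z ≡ K → K < 16 → E ≡ K
excess-cancel {E} {zero} eq K<16 = trans (sym (+-identityʳ E)) eq
excess-cancel {E} {suc Z} {K} eq K<16 = ⊥-elim (<⇒≱ K<16 (begin
  16              ≤⟨ m≤m+n 16 (16 * Z) ⟩
  16 + 16 * Z     ≡⟨ *-suc 16 Z ⟨
  16 * suc Z      ≤⟨ m≤n+m (16 * suc Z) E ⟩
  E + 16 * suc Z  ≡⟨ eq ⟩
  K               ∎))
  where open ≤-Reasoning

4∣-cancel : ∀ {S Y t} → S + 4 * Y ≡ 4 * t → 4 ∣ S
4∣-cancel {S} {Y} {t} eq =
  ∣m+n∣m⇒∣n (divides t (trans (+-comm (4 * Y) S) (trans eq (*-comm 4 t)))) (divides Y (*-comm 4 Y))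

module Excess {n} (C : HLCDCode n 3) {d} (mw : MinWeight (proj₁ C) d) (b : ℕ) (b<d : b < d) where

  G : GenMat 3 n
  G = proj₁ C

  open CodeWeights G public

  D₀ : ℕ
  D₀ = suc b

  e : Point → ℕ
  e P = W (point P) ∸ D₀

  W-point : ∀ P → W (point P) ≡ D₀ + e P
  W-point P = sym (m+[n∸m]≡n (≤-trans b<d (proj₁ mw (encode G (point P)) (point P , refl) nonzero)))
    where
    nonzero : encode G (point P) ≢ zeroW
    nonzero = point≢0 P ∘ proj₁ (proj₂ C) (point P)

  total-excess : ∀ K → 16 * n ≡ 21 * D₀ + K → ∃ λ Z → sum e + 16 * Z ≡ K
  total-excess K total with weighted-W-count (λ _ → 1) 16 column-weight-on-points
  ... | Z , eq = Z , +-cancelˡ-≡ (21 * D₀) _ _ (begin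
    21 * D₀ + (sum e + 16 * Z)     ≡⟨ +-assoc (21 * D₀) (sum e) (16 * Z) ⟨
    21 * D₀ + sum e + 16 * Z       ≡⟨ cong (_+ 16 * Z) weights ⟩
    ∑[ P < 21 ] (1 * W (point P)) + 16 * Z ≡⟨ eq ⟩
    16 * n                         ≡⟨ total ⟩
    21 * D₀ + K                    ∎)
    where
    open ≡-Reasoning
    weights : 21 * D₀ + sum e ≡ ∑[ P < 21 ] (1 * W (point P))
    weights = sym (begin
      ∑[ P < 21 ] (1 * W (point P))   ≡⟨ sum-cong-≗ (λ P → cong (1 *_) (W-point P)) ⟩
      ∑[ P < 21 ] (1 * (D₀ + e P))    ≡⟨ ∑-*-shift (λ _ → 1) e D₀ ⟩
      21 * D₀ + ∑[ P < 21 ] (1 * e P) ≡⟨ cong (21 * D₀ +_) (sum-cong-≗ (λ P → *-identityˡ (e P))) ⟩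
      21 * D₀ + sum e                 ∎)

  line-excess : ∀ L t r → 4 * n + r ≡ 5 * D₀ + 4 * t → 4 ∣ lineSum L e + r
  line-excess L t r line with weighted-W-count (χ L) 4 (column-weight-on-line L)
  ... | Y , eq = 4∣-cancel {Y = Y} {t} (+-cancelˡ-≡ (5 * D₀) _ _ (begin
    5 * D₀ + (lineSum L e + r + 4 * Y)  ≡⟨ shuffle (5 * D₀) (lineSum L e) r (4 * Y) ⟩
    5 * D₀ + lineSum L e + 4 * Y + r    ≡⟨ cong (λ x → x + 4 * Y + r) weights ⟩
    ∑[ P < 21 ] (χ L P * W (point P)) + 4 * Y + r ≡⟨ cong (_+ r) eq ⟩
    4 * n + r                           ≡⟨ line ⟩
    5 * D₀ + 4 * t                      ∎))
    where
    open ≡-Reasoning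
    shuffle : ∀ a S r y → a + (S + r + y) ≡ a + S + y + r
    shuffle = solve-∀
    weights : 5 * D₀ + lineSum L e ≡ ∑[ P < 21 ] (χ L P * W (point P))
    weights = sym (begin
      ∑[ P < 21 ] (χ L P * W (point P))  ≡⟨ sum-cong-≗ (λ P → cong (χ L P *_) (W-point P)) ⟩
      ∑[ P < 21 ] (χ L P * (D₀ + e P))   ≡⟨ ∑-*-shift (χ L) e D₀ ⟩
      sum (χ L) * D₀ + lineSum L e       ≡⟨ cong (λ x → x * D₀ + lineSum L e) (points-on-line L) ⟩
      5 * D₀ + lineSum L e               ∎)

  fromℕ-W : ∀ c P → c ≢ 𝟎 → fromℕ (W (scale c (point P))) ≡ fromℕ D₀ ⊕ fromℕ (e P)
  fromℕ-W c P c≢0 = trans (cong fromℕ (trans (W-scale c (point P) c≢0) (W-point P))) (fromℕ-+ D₀ (e P))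

  even-excess-impossible : 2 ∣ D₀ → (∀ P → 2 ∣ e P) → ⊥
  even-excess-impossible D₀-even e-even = point≢0 zero
    (LCD-radical-trivial G (proj₁ (proj₂ C)) (proj₂ (proj₂ C)) (λ _ → 𝟎) all-even (point zero) (λ _ _ _ → refl))
    where
    all-even : ∀ u → fromℕ (W u) ≡ 𝟎
    all-even u with u ≟ᵥ zeroW
    ... | yes refl = cong fromℕ W-zero
    ... | no u≢0 with projective-class u u≢0
    ...   | c , P , c≢0 , refl =
      trans (fromℕ-W c P c≢0) (cong₂ _⊕_ (fromℕ-even D₀-even) (fromℕ-even (e-even P)))

  -- With D₀ odd and e = χ L, the weight of uG has the parity of u · ℓ, a linear
  -- form in u; any nonzero point of L is then a radical.
  line-excess-impossible : fromℕ D₀ ≡ 𝟏 → ∀ L → (∀ P → e P ≡ χ L P) → ⊥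
  line-excess-impossible D₀-odd L e≡χ =
    point≢0 P₁ (LCD-radical-trivial G (proj₁ (proj₂ C)) (proj₂ (proj₂ C)) Q parity (point P₁) radical)
    where
    ℓ : Word 3
    ℓ = point L
    P₁ : Point
    P₁ = proj₁ (point-on-line L)
    Q : Word 3 → F4
    Q u = fromℕ (wt₁ (u · ℓ))
    complement : ∀ x → 𝟏 ⊕ fromℕ (1 ∸ wt₁ x) ≡ fromℕ (wt₁ x)
    complement = from-yes (all? λ x → 𝟏 ⊕ fromℕ (1 ∸ wt₁ x) ≟ fromℕ (wt₁ x))
    parity : ∀ u → fromℕ (W u) ≡ Q u
    parity u with u ≟ᵥ zeroW
    ... | yes refl = trans (cong fromℕ W-zero) (cong (fromℕ ∘ wt₁) (sym (·-zeroˡ ℓ)))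
    ... | no u≢0 with projective-class u u≢0
    ...   | c , P , c≢0 , refl = begin
      fromℕ (W (scale c (point P)))     ≡⟨ fromℕ-W c P c≢0 ⟩
      fromℕ D₀ ⊕ fromℕ (e P)            ≡⟨ cong₂ _⊕_ D₀-odd (cong fromℕ (e≡χ P)) ⟩
      𝟏 ⊕ fromℕ (1 ∸ wt₁ (point P · ℓ)) ≡⟨ complement (point P · ℓ) ⟩
      fromℕ (wt₁ (point P · ℓ))         ≡⟨ cong fromℕ (wt₁-scale c (point P · ℓ) c≢0) ⟨
      fromℕ (wt₁ (c ⊗ (point P · ℓ)))   ≡⟨ cong (fromℕ ∘ wt₁) (·-scale c (point P) ℓ) ⟨
      Q (scale c (point P))             ∎
      where open ≡-Reasoning
    cancel : ∀ x → x ⊕ 𝟎 ⊕ x ≡ 𝟎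
    cancel = from-yes (all? λ x → x ⊕ 𝟎 ⊕ x ≟ 𝟎)
    radical : ParityRadical Q (point P₁)
    radical v l l≢0 = begin
      Q (point P₁ +W scale l v) ⊕ Q (point P₁) ⊕ Q v
        ≡⟨ cong (λ x → fromℕ (wt₁ x) ⊕ Q (point P₁) ⊕ Q v) (·-linear (point P₁) v ℓ l) ⟩
      fromℕ (wt₁ (point P₁ · ℓ ⊕ l ⊗ (v · ℓ))) ⊕ Q (point P₁) ⊕ Q v
        ≡⟨ cong (λ x → fromℕ (wt₁ (x ⊕ l ⊗ (v · ℓ))) ⊕ fromℕ (wt₁ x) ⊕ Q v) (proj₂ (point-on-line L)) ⟩
      fromℕ (wt₁ (l ⊗ (v · ℓ))) ⊕ 𝟎 ⊕ Q v
        ≡⟨ cong (λ x → fromℕ x ⊕ 𝟎 ⊕ Q v) (wt₁-scale l (v · ℓ) l≢0) ⟩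
      Q v ⊕ 𝟎 ⊕ Q v
        ≡⟨ cancel (Q v) ⟩
      𝟎 ∎
      where open ≡-Reasoning

upper-bound-even : ∀ {n} (C : HLCDCode n 3) d → MinWeight (proj₁ C) d → ∀ b K → 2 ∣ suc b → K ≤ 8 →
  16 * n ≡ 21 * suc b + K → (∃ λ t → 4 * n ≡ 5 * suc b + 4 * t) → d ≤ b
upper-bound-even {n} C d mw b K even K≤8 total (t , line) = ≮⇒≥ λ b<d →
  let open Excess C mw b b<d
      Z , sum≡K = total-excess K total
      sum≤8 : sum e ≤ 8
      sum≤8 = ≤-trans (≤-trans (m≤m+n (sum e) (16 * Z)) (≤-reflexive sum≡K)) K≤8
      lines : ∀ L → 4 ∣ lineSum L e
      lines L = subst (4 ∣_) (+-identityʳ (lineSum L e)) (line-excess L t 0 (trans (+-identityʳ (4 * n)) line))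
  in even-excess-impossible even (excess-even e sum≤8 lines)

upper-bound-line : ∀ {n} (C : HLCDCode n 3) d → MinWeight (proj₁ C) d → ∀ b → fromℕ (suc b) ≡ 𝟏 →
  16 * n ≡ 21 * suc b + 5 → (∃ λ t → 4 * n + 3 ≡ 5 * suc b + 4 * t) → d ≤ b
upper-bound-line C d mw b odd total (t , line) = ≮⇒≥ λ b<d →
  let open Excess C mw b b<d
      Z , sum≡5 = total-excess 5 total
      L , e≡χ = excess-line e (excess-cancel {Z = Z} sum≡5 (from-yes (5 ℕ.<? 16)))
                              (λ L → line-excess L t 3 line)
  in line-excess-impossible odd L e≡χ

-- Lower bounds

herm-++ : ∀ {m n} (x y : Word m) (x′ y′ : Word n) → herm (x ++ x′) (y ++ y′) ≡ herm x y ⊕ herm x′ y′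
herm-++ [] [] x′ y′ = refl
herm-++ (a ∷ x) (b ∷ y) x′ y′ =
  trans (cong (a ⊗ conj b ⊕_) (herm-++ x y x′ y′)) (sym (⊕-assoc (a ⊗ conj b) (herm x y) (herm x′ y′)))

wt-map-++ : ∀ {A : Set} {m n} (f : A → F4) (xs : Vec A m) (ys : Vec A n) →
  wt (map f (xs ++ ys)) ≡ wt (map f xs) + wt (map f ys)
wt-map-++ f xs ys = trans (cong wt (map-++ f xs ys)) (wt-++ (map f xs) (map f ys))

herm-map-++ : ∀ {A : Set} {m n} (f g : A → F4) (xs : Vec A m) (ys : Vec A n) →
  herm (map f (xs ++ ys)) (map g (xs ++ ys)) ≡ herm (map f xs) (map g xs) ⊕ herm (map f ys) (map g ys)
herm-map-++ f g xs ys =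
  trans (cong₂ herm (map-++ f xs ys) (map-++ g xs ys)) (herm-++ (map f xs) (map g xs) (map f ys) (map g ys))

module _ {A : Set} {m} (xs : Vec A m) where

  wt-copies : ∀ s (f : A → F4) → wt (map f (concat (replicate s xs))) ≡ s * wt (map f xs)
  wt-copies zero f = refl
  wt-copies (suc s) f = trans (wt-map-++ f xs (concat (replicate s xs))) (cong (wt (map f xs) +_) (wt-copies s f))

  herm-copies : ∀ s (f g : A → F4) → herm (map f xs) (map g xs) ≡ 𝟎 →
    herm (map f (concat (replicate s xs))) (map g (concat (replicate s xs))) ≡ 𝟎
  herm-copies zero f g orth = refl
  herm-copies (suc s) f g orth =
    trans (herm-map-++ f g xs (concat (replicate s xs))) (cong₂ _⊕_ orth (herm-copies s f g orth))

opaque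
  simplex-weight : ∀ u → u ≢ zeroW → wt (map (u ·_) points) ≡ 16
  simplex-weight = from-yes (allᵥ? λ u → ¬? (u ≟ᵥ zeroW) →-dec wt (map (u ·_) points) ℕ.≟ 16)

  simplex-self-orthogonal : ∀ u v → herm (map (u ·_) points) (map (v ·_) points) ≡ 𝟎
  simplex-self-orthogonal = from-yes (allᵥ? λ u → allᵥ? λ v → herm (map (u ·_) points) (map (v ·_) points) ≟ 𝟎)

module Extension {c} (extra : Vec (Word 3) c) (d : ℕ)
  (extra-min : ∀ u → u ≢ zeroW → d ≤ wt (map (u ·_) extra))
  (u₀ : Word 3) (u₀≢0 : u₀ ≢ zeroW) (extra-u₀ : wt (map (u₀ ·_) extra) ≡ d)
  (extra-nondegenerate : ∀ u → u ≢ zeroW → ∃ λ v → herm (map (u ·_) extra) (map (v ·_) extra) ≢ 𝟎)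
  (s : ℕ) where

  copies : Vec (Word 3) (s * 21)
  copies = concat (replicate s points)

  columns : Vec (Word 3) (s * 21 + c)
  columns = copies ++ extra

  G : GenMat 3 (s * 21 + c)
  G = transpose columns

  encode-G : ∀ u → encode G u ≡ map (u ·_) columns
  encode-G = encode-transposed columns

  weight : ∀ u → u ≢ zeroW → wt (encode G u) ≡ 16 * s + wt (map (u ·_) extra)
  weight u u≢0 = begin
    wt (encode G u)                                   ≡⟨ cong wt (encode-G u) ⟩
    wt (map (u ·_) (copies ++ extra))                 ≡⟨ wt-map-++ (u ·_) copies extra ⟩
    wt (map (u ·_) copies) + wt (map (u ·_) extra)     ≡⟨ cong (_+ wt (map (u ·_) extra)) (wt-copies points s (u ·_)) ⟩
    s * wt (map (u ·_) points) + wt (map (u ·_) extra) ≡⟨ cong (λ x → s * x + wt (map (u ·_) extra)) (simplex-weight u u≢0) ⟩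
    s * 16 + wt (map (u ·_) extra)                    ≡⟨ cong (_+ wt (map (u ·_) extra)) (*-comm s 16) ⟩
    16 * s + wt (map (u ·_) extra)                    ∎
    where open ≡-Reasoning

  herm-G : ∀ u v → herm (encode G u) (encode G v) ≡ herm (map (u ·_) extra) (map (v ·_) extra)
  herm-G u v = begin
    herm (encode G u) (encode G v)                    ≡⟨ cong₂ herm (encode-G u) (encode-G v) ⟩
    herm (map (u ·_) columns) (map (v ·_) columns)    ≡⟨ herm-map-++ (u ·_) (v ·_) copies extra ⟩
    herm (map (u ·_) copies) (map (v ·_) copies) ⊕ herm (map (u ·_) extra) (map (v ·_) extra)
      ≡⟨ cong (_⊕ herm (map (u ·_) extra) (map (v ·_) extra)) (herm-copies points s (u ·_) (v ·_) (simplex-self-orthogonal u v)) ⟩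
    herm (map (u ·_) extra) (map (v ·_) extra)        ∎
    where open ≡-Reasoning

  nondegenerate : ∀ u → u ≢ zeroW → ∃ λ v → herm (encode G u) (encode G v) ≢ 𝟎
  nondegenerate u u≢0 = let v , ≢0 = extra-nondegenerate u u≢0 in v , ≢0 ∘ trans (sym (herm-G u v))

  independent : Independent G
  independent u uG≡0 with u ≟ᵥ zeroW
  ... | yes u≡0 = u≡0
  ... | no u≢0 = let v , ≢0 = nondegenerate u u≢0 in
    ⊥-elim (≢0 (trans (cong (λ x → herm x (encode G v)) uG≡0) (herm-zeroˡ (encode G v))))

  hermitian-LCD : HermitianLCD G
  hermitian-LCD _ (u , refl) dual with u ≟ᵥ zeroW
  ... | yes refl = encode-zero G
  ... | no u≢0 = let v , ≢0 = nondegenerate u u≢0 in ⊥-elim (≢0 (dual (encode G v) (v , refl)))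

  min-weight : MinWeight G (16 * s + d)
  min-weight = bound
             , encode G u₀ , (u₀ , refl) , u₀≢0 ∘ independent u₀
             , trans (weight u₀ u₀≢0) (cong (16 * s +_) extra-u₀)
    where
    bound : ∀ x → x ∈C G → x ≢ zeroW → 16 * s + d ≤ wt x
    bound _ (u , refl) x≢0 with u ≟ᵥ zeroW
    ... | yes refl = ⊥-elim (x≢0 (encode-zero G))
    ... | no u≢0 = subst (16 * s + d ≤_) (sym (weight u u≢0)) (+-monoʳ-≤ (16 * s) (extra-min u u≢0))

  lower-bound : ∃ λ (C : HLCDCode (21 * s + c) 3) → MinWeight (proj₁ C) (16 * s + d)
  lower-bound = subst (λ n → ∃ λ (C : HLCDCode n 3) → MinWeight (proj₁ C) (16 * s + d)) (cong (_+ c) (*-comm s 21))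
                      ((G , independent , hermitian-LCD) , min-weight)

columns₁₁ : Vec (Word 3) 11
columns₁₁ =
  (𝟏 ∷ ω ∷ 𝟎 ∷ []) ∷ (𝟏 ∷ 𝟏 ∷ 𝟎 ∷ []) ∷ (𝟏 ∷ 𝟎 ∷ ω ∷ []) ∷ (𝟎 ∷ 𝟏 ∷ 𝟎 ∷ []) ∷ (𝟎 ∷ 𝟏 ∷ 𝟏 ∷ []) ∷ (𝟏 ∷ ω ∷ ω² ∷ []) ∷
  (𝟏 ∷ ω² ∷ ω ∷ []) ∷ (𝟏 ∷ 𝟎 ∷ ω² ∷ []) ∷ (𝟏 ∷ ω ∷ ω ∷ []) ∷ (𝟎 ∷ 𝟎 ∷ 𝟏 ∷ []) ∷ (𝟎 ∷ 𝟏 ∷ ω² ∷ []) ∷ []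

columns₁₆ : Vec (Word 3) 16
columns₁₆ =
  (𝟏 ∷ 𝟎 ∷ ω² ∷ []) ∷ (𝟏 ∷ ω² ∷ 𝟏 ∷ []) ∷ (𝟎 ∷ 𝟏 ∷ ω ∷ []) ∷ (𝟏 ∷ ω ∷ ω² ∷ []) ∷ (𝟏 ∷ 𝟏 ∷ ω² ∷ []) ∷ (𝟎 ∷ 𝟏 ∷ 𝟎 ∷ []) ∷
  (𝟏 ∷ 𝟏 ∷ 𝟎 ∷ []) ∷ (𝟏 ∷ ω ∷ ω ∷ []) ∷ (𝟏 ∷ ω² ∷ ω ∷ []) ∷ (𝟏 ∷ ω ∷ 𝟎 ∷ []) ∷ (𝟎 ∷ 𝟎 ∷ 𝟏 ∷ []) ∷ (𝟏 ∷ 𝟏 ∷ 𝟏 ∷ []) ∷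
  (𝟏 ∷ 𝟎 ∷ 𝟎 ∷ []) ∷ (𝟏 ∷ ω ∷ 𝟏 ∷ []) ∷ (𝟎 ∷ 𝟏 ∷ 𝟏 ∷ []) ∷ (𝟏 ∷ 𝟎 ∷ 𝟎 ∷ []) ∷ []

columns₂₀ : Vec (Word 3) 20
columns₂₀ =
  (𝟎 ∷ 𝟏 ∷ ω² ∷ []) ∷ (𝟏 ∷ ω ∷ ω ∷ []) ∷ (𝟏 ∷ 𝟏 ∷ 𝟎 ∷ []) ∷ (𝟏 ∷ ω² ∷ ω ∷ []) ∷ (𝟏 ∷ ω ∷ 𝟎 ∷ []) ∷ (𝟏 ∷ ω² ∷ 𝟏 ∷ []) ∷
  (𝟏 ∷ 𝟎 ∷ ω ∷ []) ∷ (𝟎 ∷ 𝟏 ∷ ω ∷ []) ∷ (𝟏 ∷ 𝟏 ∷ ω² ∷ []) ∷ (𝟏 ∷ 𝟏 ∷ ω ∷ []) ∷ (𝟏 ∷ 𝟏 ∷ 𝟎 ∷ []) ∷ (𝟏 ∷ 𝟎 ∷ 𝟏 ∷ []) ∷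
  (𝟎 ∷ 𝟎 ∷ 𝟏 ∷ []) ∷ (𝟏 ∷ ω ∷ ω² ∷ []) ∷ (𝟎 ∷ 𝟏 ∷ ω ∷ []) ∷ (𝟏 ∷ ω ∷ ω² ∷ []) ∷ (𝟎 ∷ 𝟏 ∷ 𝟎 ∷ []) ∷ (𝟏 ∷ ω ∷ 𝟎 ∷ []) ∷
  (𝟏 ∷ 𝟏 ∷ 𝟏 ∷ []) ∷ (𝟎 ∷ 𝟏 ∷ 𝟎 ∷ []) ∷ []

minimum-weight? : ∀ {c} (cs : Vec (Word 3) c) d → Dec (∀ u → u ≢ zeroW → d ≤ wt (map (u ·_) cs))
minimum-weight? cs d = allᵥ? λ u → ¬? (u ≟ᵥ zeroW) →-dec d ℕ.≤? wt (map (u ·_) cs)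

nondegenerate? : ∀ {c} (cs : Vec (Word 3) c) →
  Dec (∀ u → u ≢ zeroW → ∃ λ v → herm (map (u ·_) cs) (map (v ·_) cs) ≢ 𝟎)
nondegenerate? cs = allᵥ? λ u → ¬? (u ≟ᵥ zeroW) →-dec anyᵥ? λ v → ¬? (herm (map (u ·_) cs) (map (v ·_) cs) ≟ 𝟎)

lower-bound-21s+11 : ∀ s → ∃ λ (C : HLCDCode (21 * s + 11) 3) → MinWeight (proj₁ C) (16 * s + 7)
lower-bound-21s+11 = Extension.lower-bound columns₁₁ 7 (from-yes (minimum-weight? columns₁₁ 7))
  (𝟏 ∷ 𝟎 ∷ 𝟎 ∷ []) (λ ()) refl (from-yes (nondegenerate? columns₁₁))

lower-bound-21s+16 : ∀ s → ∃ λ (C : HLCDCode (21 * s + 16) 3) → MinWeight (proj₁ C) (16 * s + 11)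
lower-bound-21s+16 = Extension.lower-bound columns₁₆ 11 (from-yes (minimum-weight? columns₁₆ 11))
  (𝟎 ∷ 𝟎 ∷ 𝟏 ∷ []) (λ ()) refl (from-yes (nondegenerate? columns₁₆))

lower-bound-21s+20 : ∀ s → ∃ λ (C : HLCDCode (21 * s + 20) 3) → MinWeight (proj₁ C) (16 * s + 14)
lower-bound-21s+20 = Extension.lower-bound columns₂₀ 14 (from-yes (minimum-weight? columns₂₀ 14))
  (𝟎 ∷ 𝟎 ∷ 𝟏 ∷ []) (λ ()) refl (from-yes (nondegenerate? columns₂₀))

upper-bound-21s+11 : ∀ s (C : HLCDCode (21 * s + 11) 3) d → MinWeight (proj₁ C) d → d ≤ 16 * s + 7
upper-bound-21s+11 s C d mw =
  upper-bound-even C d mw (16 * s + 7) 8 (divides (8 * s + 4) (even s)) ≤-refl (total s) (s + 1 , lines s)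
  where
  even : ∀ s → suc (16 * s + 7) ≡ (8 * s + 4) * 2
  even = solve-∀
  total : ∀ s → 16 * (21 * s + 11) ≡ 21 * suc (16 * s + 7) + 8
  total = solve-∀
  lines : ∀ s → 4 * (21 * s + 11) ≡ 5 * suc (16 * s + 7) + 4 * (s + 1)
  lines = solve-∀

upper-bound-21s+16 : ∀ s (C : HLCDCode (21 * s + 16) 3) d → MinWeight (proj₁ C) d → d ≤ 16 * s + 11
upper-bound-21s+16 s C d mw =
  upper-bound-even C d mw (16 * s + 11) 4 (divides (8 * s + 6) (even s)) (from-yes (4 ℕ.≤? 8)) (total s) (s + 1 , lines s)
  where
  even : ∀ s → suc (16 * s + 11) ≡ (8 * s + 6) * 2
  even = solve-∀
  total : ∀ s → 16 * (21 * s + 16) ≡ 21 * suc (16 * s + 11) + 4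
  total = solve-∀
  lines : ∀ s → 4 * (21 * s + 16) ≡ 5 * suc (16 * s + 11) + 4 * (s + 1)
  lines = solve-∀

upper-bound-21s+20 : ∀ s (C : HLCDCode (21 * s + 20) 3) d → MinWeight (proj₁ C) d → d ≤ 16 * s + 14
upper-bound-21s+20 s C d mw = upper-bound-line C d mw (16 * s + 14) odd (total s) (s + 2 , lines s)
  where
  odd : fromℕ (suc (16 * s + 14)) ≡ 𝟏
  odd = trans (cong fromℕ (sym (+-suc (16 * s) 14))) (fromℕ-16*+ s 15)
  total : ∀ s → 16 * (21 * s + 20) ≡ 21 * suc (16 * s + 14) + 5
  total = solve-∀
  lines : ∀ s → 4 * (21 * s + 20) + 3 ≡ 5 * suc (16 * s + 14) + 4 * (s + 2)
  lines = solve-∀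

proposition5p7 : (s : ℕ) →
    D4 (21 * s + 11) 3 (16 * s + 7)
    × D4 (21 * s + 16) 3 (16 * s + 11)
    × D4 (21 * s + 20) 3 (16 * s + 14)
proposition5p7 s =
    (lower-bound-21s+11 s , upper-bound-21s+11 s)
  , (lower-bound-21s+16 s , upper-bound-21s+16 s)
  , (lower-bound-21s+20 s , upper-bound-21s+20 s)
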